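{- The scheme $\mathbb{C}_1$ is deductively equivalent over $\mathrm{Kw4}$ to the scheme $$\Diamond\varphi_0\to\Diamond(\varphi_0\wedge\neg\Diamond(\neg\varphi_0\wedge\Diamond\varphi_0)),$$ and the latter scheme is deductively equivalent over $\mathrm{K}$ to the scheme $\mathrm{Grz}_\Box$: $\Box(\Box(\varphi\to\Box\varphi)\to\varphi)\to\Box\varphi$.
   Context: Modal formulas are built from variables by $\top,\neg,\wedge,\Box$, with $\Diamond=\neg\Box\neg$, $\Box^*\varphi=\varphi\wedge\Box\varphi$, $\Diamond^*\varphi=\varphi\vee\Diamond\varphi$. A normal logic is a set of formulas containing all tautologies and all instances of $\Box(\varphi\to\psi)\to(\Box\varphi\to\Box\psi)$, closed under modus ponens and $\Box$-generalisation (and uniform substitution); $\mathrm{K}$ is the smallest normal logic and $\mathrm{Kw4}$ the smallest normal logic containing all instances of w4: $\Diamond\Diamond\varphi\to\Diamond^*\varphi$. Two schemes are deductively equivalent over a normal logic $L$ if the smallest normal logic containing $L$ and the first scheme contains the second, and vice versa. $\mathbb{C}_1$ is the scheme $\Box^*\neg(\varphi_0\wedge\varphi_1)\to(\Diamond\varphi_0\to\Diamond(\varphi_0\wedge\neg\Diamond(\varphi_1\wedge\Diamond\varphi_0)))$. -}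

module Defs where

open import Data.Nat using (ℕ)
open import Data.Bool using (Bool; true; false; not; _∧_)
open import Data.List using (List; []; _∷_)
open import Data.List.Relation.Unary.Any using (Any)
open import Data.Product using (Σ; ∃; _×_)
open import Relation.Binary.PropositionalEquality using (_≡_)

data Fm : Set where
  var : ℕ → Fm
  ⊤'  : Fm
  ¬'_ : Fm → Fm
  _∧'_ : Fm → Fm → Fm
  □_  : Fm → Fm

infixr 6 _∧'_
infixr 5 _∨'_
infixr 4 _⇒_
infix 7 ¬'_ □_ ◇_ □*_ ◇*_

_∨'_ : Fm → Fm → Fm
φ ∨' ψ = ¬' (¬' φ ∧' ¬' ψ)

_⇒_ : Fm → Fm → Fm
φ ⇒ ψ = ¬' (φ ∧' ¬' ψ)

◇_ : Fm → Fm
◇ φ = ¬' □ ¬' φ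

□*_ : Fm → Fm
□* φ = φ ∧' □ φ

◇*_ : Fm → Fm
◇* φ = φ ∨' ◇ φ

sub : (ℕ → Fm) → Fm → Fm
sub σ (var n)  = σ n
sub σ ⊤'       = ⊤'
sub σ (¬' φ)   = ¬' sub σ φ
sub σ (φ ∧' ψ) = sub σ φ ∧' sub σ ψ
sub σ (□ φ)    = □ sub σ φ

-- Tautologies: formulas true under every Boolean valuation that treats
-- variables and □-formulas as atoms.
bval : (Fm → Bool) → Fm → Bool
bval v (var n)  = v (var n)
bval v ⊤'       = true
bval v (¬' φ)   = not (bval v φ)
bval v (φ ∧' ψ) = bval v φ ∧ bval v ψ
bval v (□ φ)    = v (□ φ)

Tautology : Fm → Set
Tautology φ = ∀ (v : Fm → Bool) → bval v φ ≡ true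

-- A scheme is a formula whose variables are metavariables;
-- its instances are all substitution instances.
Scheme : Set
Scheme = Fm

Inst : List Scheme → Fm → Set
Inst S φ = Any (λ s → Σ (ℕ → Fm) (λ σ → φ ≡ sub σ s)) S

-- The smallest normal logic containing all instances of the schemes in S
-- (closed under uniform substitution automatically, as the axiom set is).
data _⊢_ (S : List Scheme) : Fm → Set where
  taut : ∀ {φ} → Tautology φ → S ⊢ φ
  axK  : ∀ φ ψ → S ⊢ (□ (φ ⇒ ψ) ⇒ (□ φ ⇒ □ ψ))
  ax   : ∀ {φ} → Inst S φ → S ⊢ φ
  mp   : ∀ {φ ψ} → S ⊢ (φ ⇒ ψ) → S ⊢ φ → S ⊢ ψ
  nec  : ∀ {φ} → S ⊢ φ → S ⊢ (□ φ)

infix 2 _⊢_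

Contains : List Scheme → Scheme → Set
Contains S t = ∀ (σ : ℕ → Fm) → S ⊢ sub σ t

DedEquiv : List Scheme → Scheme → Scheme → Set
DedEquiv L s t = Contains (s ∷ L) t × Contains (t ∷ L) s

φ₀ φ₁ : Fm
φ₀ = var 0
φ₁ = var 1

w4 : Scheme
w4 = ◇ ◇ φ₀ ⇒ ◇* φ₀

Kw4 : List Scheme
Kw4 = w4 ∷ []

K : List Scheme
K = []

C1 : Scheme
C1 = □* ¬' (φ₀ ∧' φ₁) ⇒ (◇ φ₀ ⇒ ◇ (φ₀ ∧' ¬' ◇ (φ₁ ∧' ◇ φ₀)))

C1' : Scheme
C1' = ◇ φ₀ ⇒ ◇ (φ₀ ∧' ¬' ◇ (¬' φ₀ ∧' ◇ φ₀))

GrzBox : Scheme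
GrzBox = □ (□ (φ₀ ⇒ □ φ₀) ⇒ φ₀) ⇒ □ φ₀

-- ◇(¬φ ∧ ◇φ) is literally ¬□(¬φ → □¬φ), so C1' for φ is, up to propositional
-- reasoning under □, the contrapositive of Grz_□ for ¬φ; this gives the second
-- equivalence. Instantiating φ₁ := ¬φ₀ turns the antecedent of C1 into a theorem,
-- so C1 yields C1'. Conversely, w4 is dual to □*ψ → □□ψ, so □*¬(φ₀ ∧ φ₁) makes
-- ¬(φ₀ ∧ φ₁) hold at all successors; there the C1'-witness φ₀ ∧ ¬◇(¬φ₀ ∧ ◇φ₀)
-- is also a C1-witness φ₀ ∧ ¬◇(φ₁ ∧ ◇φ₀), since φ₁ forces ¬φ₀.
module Submission where

open import Defs
open import Data.Bool using (Bool; true; false; not; _∧_; T)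
open import Data.Bool.Properties using (T-∧; ¬-not) renaming (_≟_ to _≟ᵇ_)
open import Data.Fin.Subset.Properties using (anySubset?)
open import Data.List using (List; _∷_)
open import Data.List.Membership.Propositional using (_∈_)
open import Data.List.Relation.Unary.Any using (here; there)
import Data.List.Relation.Unary.Any as Any
open import Data.Nat using (ℕ; zero; suc)
open import Data.Product using (_×_; _,_; proj₁; proj₂)
open import Data.Vec using (Vec; []; _∷_; map)
open import Function using (_∘_)
open import Function.Bundles using (Equivalence)
open import Relation.Nullary.Decidable using (False; toWitnessFalse)
open import Relation.Binary.PropositionalEquality using (_≡_; refl; cong; cong₂; sym; module ≡-Reasoning)

lookupOr : ∀ {a} {A : Set a} {n} → A → Vec A n → ℕ → A
lookupOr d []       _       = d
lookupOr d (x ∷ xs) zero    = x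
lookupOr d (x ∷ xs) (suc i) = lookupOr d xs i

lookupOr-map : ∀ {a b} {A : Set a} {B : Set b} {n} (f : A → B) (d : A) (xs : Vec A n) i →
               lookupOr (f d) (map f xs) i ≡ f (lookupOr d xs i)
lookupOr-map f d []       _       = refl
lookupOr-map f d (x ∷ xs) zero    = refl
lookupOr-map f d (x ∷ xs) (suc i) = lookupOr-map f d xs i

infix 8 _[_]

_[_] : ∀ {n} → Scheme → Vec Fm n → Fm
s [ ψs ] = sub (lookupOr ⊤' ψs) s

scheme-instance : ∀ {S s} → s ∈ S → ∀ σ → S ⊢ sub σ s
scheme-instance s∈S σ = ax (Any.map (λ { refl → σ , refl }) s∈S)

boxFree : Fm → Bool
boxFree (var _)  = true
boxFree ⊤'       = true
boxFree (¬' φ)   = boxFree φ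
boxFree (φ ∧' ψ) = boxFree φ ∧ boxFree ψ
boxFree (□ _)    = false

-- The value of a □-formula is junk: eval is only used on □-free schemes.
-- Variables beyond the valuation are true, matching their substitution by ⊤'.
eval : ∀ {n} → Vec Bool n → Fm → Bool
eval ρ (var i)  = lookupOr true ρ i
eval ρ ⊤'       = true
eval ρ (¬' φ)   = not (eval ρ φ)
eval ρ (φ ∧' ψ) = eval ρ φ ∧ eval ρ ψ
eval ρ (□ _)    = false

bval-[] : ∀ {n} (v : Fm → Bool) (ψs : Vec Fm n) P → T (boxFree P) →
          bval v (P [ ψs ]) ≡ eval (map (bval v) ψs) P
bval-[] v ψs (var i)  _  = sym (lookupOr-map (bval v) ⊤' ψs i)
bval-[] v ψs ⊤'       _  = refl
bval-[] v ψs (¬' P)   bf = cong not (bval-[] v ψs P bf)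
bval-[] v ψs (P ∧' Q) bf = cong₂ _∧_ (bval-[] v ψs P (proj₁ bf′)) (bval-[] v ψs Q (proj₂ bf′))
  where bf′ = Equivalence.to T-∧ bf

tautology-instance : ∀ {S n} P (ψs : Vec Fm n) {_ : T (boxFree P)}
                     {_ : False (anySubset? {n = n} (λ ρ → eval ρ P ≟ᵇ false))} → S ⊢ P [ ψs ]
tautology-instance P ψs {bf} {valid} = taut λ v → begin
  bval v (P [ ψs ])         ≡⟨ bval-[] v ψs P bf ⟩
  eval (map (bval v) ψs) P  ≡⟨ ¬-not (λ e → toWitnessFalse valid (map (bval v) ψs , e)) ⟩
  true                      ∎
  where open ≡-Reasoning

φ₂ φ₃ : Fm
φ₂ = var 2
φ₃ = var 3

module _ {S : List Scheme} where

  ⇒-trans : ∀ {A B C} → S ⊢ A ⇒ B → S ⊢ B ⇒ C → S ⊢ A ⇒ C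
  ⇒-trans {A} {B} {C} = mp ∘ mp (tautology-instance ((φ₀ ⇒ φ₁) ⇒ (φ₁ ⇒ φ₂) ⇒ (φ₀ ⇒ φ₂)) (A ∷ B ∷ C ∷ []))

  ⇒-mono : ∀ {A A′ B B′} → S ⊢ A′ ⇒ A → S ⊢ B ⇒ B′ → S ⊢ (A ⇒ B) ⇒ (A′ ⇒ B′)
  ⇒-mono {A} {A′} {B} {B′} = mp ∘ mp (tautology-instance
    ((φ₁ ⇒ φ₀) ⇒ (φ₂ ⇒ φ₃) ⇒ (φ₀ ⇒ φ₂) ⇒ (φ₁ ⇒ φ₃)) (A ∷ A′ ∷ B ∷ B′ ∷ []))

  ∧-mono : ∀ {A A′ B B′} → S ⊢ A ⇒ A′ → S ⊢ B ⇒ B′ → S ⊢ A ∧' B ⇒ A′ ∧' B′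
  ∧-mono {A} {A′} {B} {B′} = mp ∘ mp (tautology-instance
    ((φ₀ ⇒ φ₁) ⇒ (φ₂ ⇒ φ₃) ⇒ (φ₀ ∧' φ₂ ⇒ φ₁ ∧' φ₃)) (A ∷ A′ ∷ B ∷ B′ ∷ []))

  ⇒-refl : ∀ {A} → S ⊢ A ⇒ A
  ⇒-refl {A} = tautology-instance (φ₀ ⇒ φ₀) (A ∷ [])

  ¬¬-intro : ∀ {A} → S ⊢ A ⇒ ¬' ¬' A
  ¬¬-intro {A} = tautology-instance (φ₀ ⇒ ¬' ¬' φ₀) (A ∷ [])

  ¬¬-elim : ∀ {A} → S ⊢ ¬' ¬' A ⇒ A
  ¬¬-elim {A} = tautology-instance (¬' ¬' φ₀ ⇒ φ₀) (A ∷ [])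

  contraposition : ∀ {A B} → S ⊢ (A ⇒ B) ⇒ (¬' B ⇒ ¬' A)
  contraposition {A} {B} = tautology-instance ((φ₀ ⇒ φ₁) ⇒ (¬' φ₁ ⇒ ¬' φ₀)) (A ∷ B ∷ [])

  contraposition⁻¹ : ∀ {A B} → S ⊢ (¬' A ⇒ ¬' B) ⇒ (B ⇒ A)
  contraposition⁻¹ {A} {B} = tautology-instance ((¬' φ₀ ⇒ ¬' φ₁) ⇒ (φ₁ ⇒ φ₀)) (A ∷ B ∷ [])

  □*-intro : ∀ {A} → S ⊢ A → S ⊢ □* A
  □*-intro {A} ⊢A = mp (mp (tautology-instance (φ₀ ⇒ φ₁ ⇒ φ₀ ∧' φ₁) (A ∷ □ A ∷ [])) ⊢A) (nec ⊢A)

  □-mono : ∀ {A B} → S ⊢ A ⇒ B → S ⊢ □ A ⇒ □ B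
  □-mono {A} {B} = mp (axK A B) ∘ nec

  □-¬¬-intro : ∀ {A} → S ⊢ □ A ⇒ □ ¬' ¬' A
  □-¬¬-intro = □-mono ¬¬-intro

  □-¬¬-elim : ∀ {A} → S ⊢ □ ¬' ¬' A ⇒ □ A
  □-¬¬-elim = □-mono ¬¬-elim

  ◇-mono : ∀ {A B} → S ⊢ □ (A ⇒ B) ⇒ ◇ A ⇒ ◇ B
  ◇-mono {A} {B} = ⇒-trans (□-mono contraposition) (⇒-trans (axK (¬' B) (¬' A)) contraposition)

  □*⇒□□ : ∀ {A} → Contains S w4 → S ⊢ □* A ⇒ □ □ A
  □*⇒□□ {A} w4∈S = ⇒-trans (∧-mono ¬¬-intro (⇒-trans □-¬¬-intro ¬¬-intro))
                  (⇒-trans (mp contraposition⁻¹ (w4∈S (λ _ → ¬' A)))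
                           (□-mono (⇒-trans ¬¬-elim □-¬¬-elim)))

  GrzBox-cong : ∀ {A B} → S ⊢ A ⇒ B → S ⊢ B ⇒ A → S ⊢ GrzBox [ A ∷ [] ] ⇒ GrzBox [ B ∷ [] ]
  GrzBox-cong A⇒B B⇒A = ⇒-mono (□-mono (⇒-mono (□-mono (⇒-mono B⇒A (□-mono A⇒B))) B⇒A)) (□-mono A⇒B)

  GrzBox¬⇒C1′ : ∀ p → S ⊢ GrzBox [ ¬' p ∷ [] ] ⇒ C1' [ p ∷ [] ]
  GrzBox¬⇒C1′ p = ⇒-trans (⇒-mono (□-mono (tautology-instance
      (¬' (φ₀ ∧' ¬' ¬' φ₁) ⇒ (φ₁ ⇒ ¬' φ₀)) (p ∷ □ (¬' p ⇒ □ ¬' p) ∷ []))) ⇒-refl) contraposition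

  C1′⇒GrzBox¬ : ∀ p → S ⊢ C1' [ p ∷ [] ] ⇒ GrzBox [ ¬' p ∷ [] ]
  C1′⇒GrzBox¬ p = ⇒-trans contraposition⁻¹ (⇒-mono (□-mono (tautology-instance
      ((φ₁ ⇒ ¬' φ₀) ⇒ ¬' (φ₀ ∧' ¬' ¬' φ₁)) (p ∷ □ (¬' p ⇒ □ ¬' p) ∷ []))) ⇒-refl)

  C1′-witness⇒C1-witness : ∀ p r → S ⊢ □ ¬' (p ∧' r) ⇒
                           (p ∧' ¬' ◇ (¬' p ∧' ◇ p)) ⇒ (p ∧' ¬' ◇ (r ∧' ◇ p))
  C1′-witness⇒C1-witness p r = ⇒-trans
    (□-mono (tautology-instance (¬' (φ₀ ∧' φ₁) ⇒ ¬' (¬' φ₀ ∧' φ₂) ⇒ ¬' (φ₁ ∧' φ₂)) (p ∷ r ∷ ◇ p ∷ [])))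
    (⇒-trans (axK (¬' (¬' p ∧' ◇ p)) (¬' (r ∧' ◇ p)))
             (tautology-instance ((φ₀ ⇒ φ₁) ⇒ (φ₂ ∧' ¬' ¬' φ₀ ⇒ φ₂ ∧' ¬' ¬' φ₁))
                                 (□ ¬' (¬' p ∧' ◇ p) ∷ □ ¬' (r ∧' ◇ p) ∷ p ∷ [])))

C1⊢C1′ : Contains (C1 ∷ Kw4) C1'
C1⊢C1′ σ = mp (scheme-instance (here refl) (lookupOr ⊤' (p ∷ ¬' p ∷ [])))
              (□*-intro (tautology-instance (¬' (φ₀ ∧' ¬' φ₀)) (p ∷ [])))
  where p = σ 0

C1′⊢C1 : Contains (C1' ∷ Kw4) C1
C1′⊢C1 σ = ⇒-trans (⇒-trans (□*⇒□□ (scheme-instance (there (here refl))))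
                            (⇒-trans (□-mono (C1′-witness⇒C1-witness p r)) ◇-mono))
                   (⇒-mono (scheme-instance (here refl) σ) ⇒-refl)
  where p = σ 0
        r = σ 1

C1′⊢GrzBox : Contains (C1' ∷ K) GrzBox
C1′⊢GrzBox σ = mp (GrzBox-cong ¬¬-elim ¬¬-intro)
                (mp (C1′⇒GrzBox¬ (¬' q)) (scheme-instance (here refl) (λ _ → ¬' q)))
  where q = σ 0

GrzBox⊢C1′ : Contains (GrzBox ∷ K) C1'
GrzBox⊢C1′ σ = mp (GrzBox¬⇒C1′ (σ 0)) (scheme-instance (here refl) (λ _ → ¬' σ 0))

theorem5p1 : DedEquiv Kw4 C1 C1' × DedEquiv K C1' GrzBox
theorem5p1 = (C1⊢C1′ , C1′⊢C1) , (C1′⊢GrzBox , GrzBox⊢C1′)
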